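{- Let $B=F(b_1,\ldots,b_n)$ be a Ferrers board with $0\le b_1\le\cdots\le b_n$ and $b_n>0$, and let $x$ be an integer with $x\ge b_n$. Then $$[x]_q^n=\sum_{k=0}^n\mathbf{RT}_{n-k}(B,q)\,[x-F_{b_1}]_q[x-F_{b_2}]_q\cdots[x-F_{b_k}]_q.$$
   Context: Fibonacci numbers: $F_0=0$, $F_1=1$, $F_m=F_{m-1}+F_{m-2}$. For any integer $m$, $[m]_q=\frac{1-q^m}{1-q}$ (a rational function of $q$; $[0]_q=0$). For $m\ge1$, $\mathcal{F}_m$ is the set of tilings of a column of height $m$ (levels $1,\dots,m$ from the bottom) by tiles of heights 1 and 2 whose bottom-most tile has height 1; $\mathcal{F}_0=\emptyset$. For $T\in\mathcal{F}_m$, $\mathrm{rank}_m(T)=\sum F_{i-1}$, the sum over all $i$ such that $T$ has a tile of height 2 occupying levels $i-1$ and $i$. A Ferrers board $F(b_1,\dots,b_n)$ has columns $1,\dots,n$ of heights $b_1\le\cdots\le b_n$. For $0\le k\le n$, $\mathcal{NT}_k(B)$ is the set of Fibonacci rook placements with $k$ tilings: a sequence of columns $1\le i_1<\cdots<i_k\le n$ together with, for each $s=1,\dots,k$, a tiling $T_{i_s}\in\mathcal{F}_{e_s}$ where $e_s=b_{i_s-s+1}$ (geometrically, each tiling cancels top cells of the columns to its right so that after $s$ tilings the untiled columns have $b_1,\dots,b_{n-s}$ uncanceled cells from left to right). For $k=0$ only the empty placement exists. For such $P$, $W_{B,q}(P)=q^{\sum_{s=1}^k\mathrm{rank}_{e_s}(T_{i_s})+\sum_{t=1}^{n-k}F_{b_t}}$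 and $\mathbf{RT}_k(B,q)=\sum_{P\in\mathcal{NT}_k(B)}W_{B,q}(P)$. An empty product equals 1. -}

module Defs where

open import Data.Nat as ℕ using (ℕ; zero; suc; _∸_)
open import Data.Integer as ℤ using (ℤ; +_; -[1+_])
open import Data.Rational as ℚ using (ℚ; 0ℚ; 1ℚ; _+_; _*_; _-_; -_; _÷_; 1/_; NonZero; ≢-nonZero)
open import Data.Rational.Properties using (+-identityˡ; +-identityʳ; +-assoc; +-inverseˡ)
open import Data.List using (List; []; _∷_; map; _++_; concatMap; foldr; take; length; upTo)
open import Data.Product using (_×_; _,_; proj₂)
open import Relation.Binary.PropositionalEquality using (_≡_; _≢_; refl; sym; trans; cong; cong₂)

fib : ℕ → ℕ
fib zero = 0
fib (suc zero) = 1
fib (suc (suc m)) = fib (suc m) ℕ.+ fib m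

infixr 8 _^ℕ_
_^ℕ_ : ℚ → ℕ → ℚ
q ^ℕ zero = 1ℚ
q ^ℕ suc n = q * (q ^ℕ n)

_^ℤ_ : (q : ℚ) → .{{_ : NonZero q}} → ℤ → ℚ
q ^ℤ (+ n) = q ^ℕ n
q ^ℤ -[1+ n ] = (1/ q) ^ℕ suc n

1-q≢0 : ∀ {q} → q ≢ 1ℚ → (1ℚ - q) ≢ 0ℚ
1-q≢0 {q} q≢1 eq = q≢1 (trans (sym (+-identityˡ q))
  (trans (cong (_+ q) (sym eq))
  (trans (+-assoc 1ℚ (- q) q)
  (trans (cong (λ z → 1ℚ + z) (+-inverseˡ q)) (+-identityʳ 1ℚ)))))

qint : ℤ → (q : ℚ) → q ≢ 0ℚ → q ≢ 1ℚ → ℚ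
qint m q q≢0 q≢1 =
  let instance _ = ≢-nonZero q≢0
               _ = ≢-nonZero (1-q≢0 q≢1)
  in (1ℚ - (q ^ℤ m)) ÷ (1ℚ - q)

sumℚ : List ℚ → ℚ
sumℚ = foldr _+_ 0ℚ

prodℚ : List ℚ → ℚ
prodℚ = foldr _*_ 1ℚ

sumℕ : List ℕ → ℕ
sumℕ = foldr ℕ._+_ 0

-- Tilings of a column by tiles of height 1 and 2, listed bottom to top

data Tile : Set where
  one two : Tile

Tiling : Set
Tiling = List Tile

allTilings : ℕ → List Tiling
allTilings zero = [] ∷ []
allTilings (suc zero) = (one ∷ []) ∷ []
allTilings (suc (suc m)) =
  map (one ∷_) (allTilings (suc m)) ++ map (two ∷_) (allTilings m)

𝓕 : ℕ → List Tiling
𝓕 zero = []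
𝓕 (suc m) = map (one ∷_) (allTilings m)

-- rankFrom l T: T sits on top of l already-filled levels; a height-2 tile
-- occupying levels i-1, i (i = l+2) contributes F_{i-1} = F_{l+1}.
rankFrom : ℕ → Tiling → ℕ
rankFrom l [] = 0
rankFrom l (one ∷ T) = rankFrom (suc l) T
rankFrom l (two ∷ T) = fib (suc l) ℕ.+ rankFrom (suc (suc l)) T

rank : Tiling → ℕ
rank = rankFrom 0

-- Ferrers boards F(b_1,…,b_n), given as the list b = [b_1,…,b_n]

-- 1-indexed column height b_j (0 outside range; never used there)
col : List ℕ → ℕ → ℕ
col [] j = 0
col (x ∷ xs) zero = 0
col (x ∷ xs) (suc zero) = x
col (x ∷ xs) (suc (suc j)) = col xs (suc j)

lastOr0 : List ℕ → ℕ
lastOr0 [] = 0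
lastOr0 (x ∷ []) = x
lastOr0 (x ∷ y ∷ xs) = lastOr0 (y ∷ xs)

choose : List ℕ → ℕ → List (List ℕ)
choose xs zero = [] ∷ []
choose [] (suc k) = []
choose (x ∷ xs) (suc k) = map (x ∷_) (choose xs k) ++ choose xs (suc k)

columns : ℕ → List ℕ
columns n = map suc (upTo n)

-- A Fibonacci rook placement: list of pairs (i_s , T_{i_s}), s = 1,…,k
Placement : Set
Placement = List (ℕ × Tiling)

-- given s and the remaining columns i_s < i_{s+1} < …, all choices of
-- T_{i_s} ∈ 𝓕_{e_s}, e_s = b_{i_s - s + 1}, etc.
tilingChoices : List ℕ → ℕ → List ℕ → List Placement
tilingChoices b s [] = [] ∷ []
tilingChoices b s (i ∷ is) =
  concatMap (λ T → map ((i , T) ∷_) (tilingChoices b (suc s) is))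
            (𝓕 (col b (suc (i ∸ s))))

NT : ℕ → List ℕ → List Placement
NT k b = concatMap (tilingChoices b 1) (choose (columns (length b)) k)

W : List ℕ → ℕ → ℚ → Placement → ℚ
W b k q P = q ^ℕ (sumℕ (map (λ p → rank (proj₂ p)) P)
                  ℕ.+ sumℕ (map fib (take (length b ∸ k) b)))

RT : ℕ → List ℕ → ℚ → ℚ
RT k b q = sumℚ (map (W b k q) (NT k b))

-- Summing out the tilings, RT_j(B,q) is q^{F_{b_1}+⋯+F_{b_{n-j}}} times the rook number r_j of
-- the board whose i-th column carries the weight a_i = Σ_{T ∈ 𝓕_{b_i}} q^{rank T} = [F_{b_i}]_q
-- (removing the top tile gives [F_{m+2}]_q = [F_{m+1}]_q + q^{F_{m+1}} [F_m]_q).  For arbitrary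
-- column weights the rook numbers satisfy X^n = Σ_k r_{n-k} (X − a_1)⋯(X − a_k), by induction on n
-- according to whether the first column carries a rook.  At X = [x]_q the factors become
-- [x]_q − [F_b]_q = q^{F_b} [x − F_b]_q.
module Submission where

open import Defs
open import Data.Nat using (ℕ; suc; _≤_; _<_; _∸_)
open import Data.Integer as ℤ using (ℤ; +_)
open import Data.Rational using (ℚ; 0ℚ; 1ℚ; _+_; _*_)
open import Data.List using (List; length; map; take; upTo)
open import Data.List.Relation.Unary.Linked using (Linked)
open import Relation.Binary.PropositionalEquality using (_≡_; _≢_)

open import Data.Nat as ℕ using (zero; s≤s)
import Data.Nat.Properties as ℕP
import Data.Integer.Properties as ℤP
open import Data.Rational using (_-_; 1/_; NonZero; ≢-nonZero)
import Data.Rational.Properties as ℚP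
open import Data.Rational.Solver using (module +-*-Solver)
open import Algebra.Properties.AbelianGroup ℤP.+-0-abelianGroup using (xyx⁻¹≈y)
open import Data.List using ([]; _∷_; _++_; concatMap; applyUpTo)
open import Data.List.Properties using (map-++; map-cong; map-∘; map-applyUpTo)
open import Data.Product using (_,_; proj₂)
open import Function using (_∘_; id)
open import Relation.Binary.PropositionalEquality using (refl; sym; trans; cong; cong₂; module ≡-Reasoning)

open +-*-Solver
open ≡-Reasoning

^ℕ-+ : ∀ q a b → q ^ℕ (a ℕ.+ b) ≡ q ^ℕ a * q ^ℕ b
^ℕ-+ q zero b = sym (ℚP.*-identityˡ _)
^ℕ-+ q (suc a) b = trans (cong (q *_) (^ℕ-+ q a b)) (sym (ℚP.*-assoc q _ _))

sumℚ-++ : ∀ xs ys → sumℚ (xs ++ ys) ≡ sumℚ xs + sumℚ ys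
sumℚ-++ [] ys = sym (ℚP.+-identityˡ _)
sumℚ-++ (x ∷ xs) ys = trans (cong (_+_ x) (sumℚ-++ xs ys)) (sym (ℚP.+-assoc x _ _))

sumℚ-map-*ˡ : ∀ {A : Set} c (f : A → ℚ) xs → sumℚ (map (λ a → c * f a) xs) ≡ c * sumℚ (map f xs)
sumℚ-map-*ˡ c f [] = sym (ℚP.*-zeroʳ c)
sumℚ-map-*ˡ c f (x ∷ xs) =
  trans (cong (_+_ (c * f x)) (sumℚ-map-*ˡ c f xs)) (sym (ℚP.*-distribˡ-+ c _ _))

sumℚ-map-*ʳ : ∀ {A : Set} c (f : A → ℚ) xs → sumℚ (map (λ a → f a * c) xs) ≡ sumℚ (map f xs) * c
sumℚ-map-*ʳ c f xs = begin
  sumℚ (map (λ a → f a * c) xs) ≡⟨ cong sumℚ (map-cong (λ a → ℚP.*-comm (f a) c) xs) ⟩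
  sumℚ (map (λ a → c * f a) xs) ≡⟨ sumℚ-map-*ˡ c f xs ⟩
  c * sumℚ (map f xs)           ≡⟨ ℚP.*-comm c _ ⟩
  sumℚ (map f xs) * c           ∎

sumℚ-map-++ : ∀ {A : Set} (f : A → ℚ) xs ys → sumℚ (map f (xs ++ ys)) ≡ sumℚ (map f xs) + sumℚ (map f ys)
sumℚ-map-++ f xs ys = trans (cong sumℚ (map-++ f xs ys)) (sumℚ-++ (map f xs) (map f ys))

sumℚ-concatMap : ∀ {A B : Set} (f : B → ℚ) (g : A → List B) xs →
  sumℚ (map f (concatMap g xs)) ≡ sumℚ (map (λ a → sumℚ (map f (g a))) xs)
sumℚ-concatMap f g [] = refl
sumℚ-concatMap f g (x ∷ xs) =
  trans (sumℚ-map-++ f (g x) (concatMap g xs)) (cong (_+_ (sumℚ (map f (g x)))) (sumℚ-concatMap f g xs))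

sumBelow : ℕ → (ℕ → ℚ) → ℚ
sumBelow zero f = 0ℚ
sumBelow (suc n) f = f 0 + sumBelow n (f ∘ suc)

sumℚ-map-applyUpTo : ∀ (f : ℕ → ℚ) g n → sumℚ (map f (applyUpTo g n)) ≡ sumBelow n (f ∘ g)
sumℚ-map-applyUpTo f g zero = refl
sumℚ-map-applyUpTo f g (suc n) = cong (_+_ (f (g 0))) (sumℚ-map-applyUpTo f (g ∘ suc) n)

sumBelow-cong : ∀ n {f g : ℕ → ℚ} → (∀ k → k < n → f k ≡ g k) → sumBelow n f ≡ sumBelow n g
sumBelow-cong zero eq = refl
sumBelow-cong (suc n) eq =
  cong₂ _+_ (eq 0 (s≤s ℕ.z≤n)) (sumBelow-cong n (λ k k<n → eq (suc k) (s≤s k<n)))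

sumBelow-+ : ∀ n f g → sumBelow n (λ k → f k + g k) ≡ sumBelow n f + sumBelow n g
sumBelow-+ zero f g = sym (ℚP.+-identityˡ 0ℚ)
sumBelow-+ (suc n) f g = trans (cong (_+_ (f 0 + g 0)) (sumBelow-+ n (f ∘ suc) (g ∘ suc)))
  (solve 4 (λ a b c d → (a :+ b) :+ (c :+ d) := (a :+ c) :+ (b :+ d)) refl
    (f 0) (g 0) (sumBelow n (f ∘ suc)) (sumBelow n (g ∘ suc)))

sumBelow-*ˡ : ∀ n c f → sumBelow n (λ k → c * f k) ≡ c * sumBelow n f
sumBelow-*ˡ zero c f = sym (ℚP.*-zeroʳ c)
sumBelow-*ˡ (suc n) c f =
  trans (cong (_+_ (c * f 0)) (sumBelow-*ˡ n c (f ∘ suc))) (sym (ℚP.*-distribˡ-+ c _ _))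

sumBelow-suc : ∀ n f → sumBelow (suc n) f ≡ sumBelow n f + f n
sumBelow-suc zero f = ℚP.+-comm (f 0) 0ℚ
sumBelow-suc (suc n) f =
  trans (cong (_+_ (f 0)) (sumBelow-suc n (f ∘ suc))) (sym (ℚP.+-assoc (f 0) _ _))

-- Rook numbers of a Ferrers board whose i-th column (from 0) offers a i cells once the
-- rooks to its left have cancelled theirs: a rook in the first column uses a 0 and leaves
-- the weights of the remaining columns unchanged, an empty first column shifts them.
rook : (ℕ → ℚ) → ℕ → ℕ → ℚ
rook a m zero = 1ℚ
rook a zero (suc j) = 0ℚ
rook a (suc m) (suc j) = a 0 * rook a m j + rook (a ∘ suc) m (suc j)

rook-overfull : ∀ a {m j} → m < j → rook a m j ≡ 0ℚ
rook-overfull a {zero} {suc j} _ = refl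
rook-overfull a {suc m} {suc j} (s≤s m<j) = begin
  a 0 * rook a m j + rook (a ∘ suc) m (suc j)
    ≡⟨ cong₂ (λ u v → a 0 * u + v) (rook-overfull a m<j) (rook-overfull (a ∘ suc) (ℕP.m≤n⇒m≤1+n m<j)) ⟩
  a 0 * 0ℚ + 0ℚ
    ≡⟨ trans (ℚP.+-identityʳ _) (ℚP.*-zeroʳ (a 0)) ⟩
  0ℚ ∎

falling : ℚ → (ℕ → ℚ) → ℕ → ℚ
falling X a zero = 1ℚ
falling X a (suc k) = (X - a 0) * falling X (a ∘ suc) k

rookExpansion : ℚ → (ℕ → ℚ) → ℕ → ℚ
rookExpansion X a m = sumBelow (suc m) (λ k → rook a m (m ∸ k) * falling X a k)

rookExpansion-last : ∀ X a m →
  rookExpansion X a m ≡ sumBelow m (λ k → rook a m (m ∸ k) * falling X a k) + falling X a m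
rookExpansion-last X a m = begin
  rookExpansion X a m
    ≡⟨ sumBelow-suc m _ ⟩
  init + rook a m (m ∸ m) * falling X a m
    ≡⟨ cong (λ j → init + rook a m j * falling X a m) (ℕP.n∸n≡0 m) ⟩
  init + 1ℚ * falling X a m
    ≡⟨ cong (_+_ init) (ℚP.*-identityˡ _) ⟩
  init + falling X a m ∎
  where init = sumBelow m (λ k → rook a m (m ∸ k) * falling X a k)

rookExpansion-suc : ∀ X a m →
  rookExpansion X a (suc m) ≡ a 0 * rookExpansion X a m + (X - a 0) * rookExpansion X (a ∘ suc) m
rookExpansion-suc X a m = begin
  sumBelow (suc (suc m)) term
    ≡⟨ sumBelow-suc (suc m) term ⟩
  sumBelow (suc m) term + term (suc m)
    ≡⟨ cong₂ _+_ split-first-column rook-in-every-column ⟩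
  (a 0 * rookExpansion X a m + sumBelow (suc m) first-empty) + (X - a 0) * falling X a′ m
    ≡⟨ cong (λ u → (a 0 * rookExpansion X a m + u) + (X - a 0) * falling X a′ m) first-empty-sum ⟩
  (a 0 * rookExpansion X a m + (X - a 0) * rest) + (X - a 0) * falling X a′ m
    ≡⟨ solve 5 (λ g e y r f → (g :* e :+ y :* r) :+ y :* f := g :* e :+ y :* (r :+ f)) refl
         (a 0) (rookExpansion X a m) (X - a 0) rest (falling X a′ m) ⟩
  a 0 * rookExpansion X a m + (X - a 0) * (rest + falling X a′ m)
    ≡⟨ cong (λ u → a 0 * rookExpansion X a m + (X - a 0) * u) (rookExpansion-last X a′ m) ⟨
  a 0 * rookExpansion X a m + (X - a 0) * rookExpansion X a′ m ∎
  where
    a′ = a ∘ suc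
    term first-empty : ℕ → ℚ
    term k = rook a (suc m) (suc m ∸ k) * falling X a k
    first-empty k = rook a′ m (suc (m ∸ k)) * falling X a k
    rest = sumBelow m (λ k → rook a′ m (m ∸ k) * falling X a′ k)

    split-first-column : sumBelow (suc m) term ≡ a 0 * rookExpansion X a m + sumBelow (suc m) first-empty
    split-first-column = begin
      sumBelow (suc m) term
        ≡⟨ sumBelow-cong (suc m) split ⟩
      sumBelow (suc m) (λ k → a 0 * (rook a m (m ∸ k) * falling X a k) + first-empty k)
        ≡⟨ sumBelow-+ (suc m) (λ k → a 0 * (rook a m (m ∸ k) * falling X a k)) first-empty ⟩
      sumBelow (suc m) (λ k → a 0 * (rook a m (m ∸ k) * falling X a k)) + sumBelow (suc m) first-empty
        ≡⟨ cong (_+ sumBelow (suc m) first-empty) (sumBelow-*ˡ (suc m) (a 0) (λ k → rook a m (m ∸ k) * falling X a k)) ⟩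
      a 0 * rookExpansion X a m + sumBelow (suc m) first-empty ∎
      where
        split : ∀ k → k < suc m → term k ≡ a 0 * (rook a m (m ∸ k) * falling X a k) + first-empty k
        split k (s≤s k≤m) = trans (cong (λ j → rook a (suc m) j * falling X a k) (ℕP.+-∸-assoc 1 k≤m))
          (solve 4 (λ g r r′ f → (g :* r :+ r′) :* f := g :* (r :* f) :+ r′ :* f) refl
            (a 0) (rook a m (m ∸ k)) (rook a′ m (suc (m ∸ k))) (falling X a k))

    rook-in-every-column : term (suc m) ≡ (X - a 0) * falling X a′ m
    rook-in-every-column = trans (cong (λ j → rook a (suc m) j * falling X a (suc m)) (ℕP.n∸n≡0 m))
      (ℚP.*-identityˡ _)

    first-empty-sum : sumBelow (suc m) first-empty ≡ (X - a 0) * rest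
    first-empty-sum = begin
      first-empty 0 + sumBelow m (first-empty ∘ suc)
        ≡⟨ cong₂ _+_ (trans (cong (_* 1ℚ) (rook-overfull a′ (ℕP.n<1+n m))) (ℚP.*-zeroˡ 1ℚ))
                     (sumBelow-cong m shift) ⟩
      0ℚ + sumBelow m (λ k → (X - a 0) * (rook a′ m (m ∸ k) * falling X a′ k))
        ≡⟨ trans (ℚP.+-identityˡ _) (sumBelow-*ˡ m (X - a 0) _) ⟩
      (X - a 0) * rest ∎
      where
        shift : ∀ k → k < m → first-empty (suc k) ≡ (X - a 0) * (rook a′ m (m ∸ k) * falling X a′ k)
        shift k k<m = trans (cong (λ j → rook a′ m j * falling X a (suc k)) (sym (ℕP.+-∸-assoc 1 k<m)))
          (solve 3 (λ r y f → r :* (y :* f) := y :* (r :* f)) refl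
            (rook a′ m (m ∸ k)) (X - a 0) (falling X a′ k))

rookExpansion≡^ : ∀ X a m → rookExpansion X a m ≡ X ^ℕ m
rookExpansion≡^ X a zero = trans (ℚP.+-identityʳ _) (ℚP.*-identityˡ 1ℚ)
rookExpansion≡^ X a (suc m) = begin
  rookExpansion X a (suc m)
    ≡⟨ rookExpansion-suc X a m ⟩
  a 0 * rookExpansion X a m + (X - a 0) * rookExpansion X (a ∘ suc) m
    ≡⟨ cong₂ (λ u v → a 0 * u + (X - a 0) * v) (rookExpansion≡^ X a m) (rookExpansion≡^ X (a ∘ suc) m) ⟩
  a 0 * X ^ℕ m + (X - a 0) * X ^ℕ m
    ≡⟨ solve 3 (λ g x p → g :* p :+ (x :- g) :* p := x :* p) refl (a 0) X (X ^ℕ m) ⟩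
  X ^ℕ suc m ∎

module QIntegers (q : ℚ) (q≢0 : q ≢ 0ℚ) (q≢1 : q ≢ 1ℚ) where
  instance
    q-nonZero : NonZero q
    q-nonZero = ≢-nonZero q≢0
    1-q-nonZero : NonZero (1ℚ - q)
    1-q-nonZero = ≢-nonZero (1-q≢0 q≢1)

  [_] : ℤ → ℚ
  [ m ] = qint m q q≢0 q≢1

  *-^ℤ-suc : ∀ w → q * q ^ℤ w ≡ q ^ℤ ℤ.suc w
  *-^ℤ-suc (+ n) = refl
  *-^ℤ-suc ℤ.-[1+ zero ] = trans (cong (q *_) (ℚP.*-identityʳ (1/ q))) (ℚP.*-inverseʳ q)
  *-^ℤ-suc ℤ.-[1+ suc n ] = begin
    q * (1/ q * (1/ q) ^ℕ suc n) ≡⟨ ℚP.*-assoc q (1/ q) _ ⟨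
    q * 1/ q * (1/ q) ^ℕ suc n   ≡⟨ cong (_* (1/ q) ^ℕ suc n) (ℚP.*-inverseʳ q) ⟩
    1ℚ * (1/ q) ^ℕ suc n         ≡⟨ ℚP.*-identityˡ _ ⟩
    (1/ q) ^ℕ suc n              ∎

  ^ℕ-*-^ℤ : ∀ a w → q ^ℕ a * q ^ℤ w ≡ q ^ℤ (+ a ℤ.+ w)
  ^ℕ-*-^ℤ zero w = trans (ℚP.*-identityˡ _) (cong (q ^ℤ_) (sym (ℤP.+-identityˡ w)))
  ^ℕ-*-^ℤ (suc a) w = begin
    q * q ^ℕ a * q ^ℤ w     ≡⟨ ℚP.*-assoc q _ _ ⟩
    q * (q ^ℕ a * q ^ℤ w)   ≡⟨ cong (q *_) (^ℕ-*-^ℤ a w) ⟩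
    q * q ^ℤ (+ a ℤ.+ w)    ≡⟨ *-^ℤ-suc (+ a ℤ.+ w) ⟩
    q ^ℤ ℤ.suc (+ a ℤ.+ w)  ≡⟨ cong (q ^ℤ_) (ℤP.suc-+ a w) ⟨
    q ^ℤ (+ suc a ℤ.+ w)    ∎

  [+]-+ : ∀ a w → [ + a ℤ.+ w ] ≡ [ + a ] + q ^ℕ a * [ w ]
  [+]-+ a w = begin
    (1ℚ - q ^ℤ (+ a ℤ.+ w)) * d     ≡⟨ cong (λ e → (1ℚ - e) * d) (^ℕ-*-^ℤ a w) ⟨
    (1ℚ - q ^ℕ a * q ^ℤ w) * d      ≡⟨ solve 3 (λ u v d → (con 1ℚ :- u :* v) :* d
                                          := (con 1ℚ :- u) :* d :+ u :* ((con 1ℚ :- v) :* d))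
                                          refl (q ^ℕ a) (q ^ℤ w) d ⟩
    [ + a ] + q ^ℕ a * [ w ]        ∎
    where d = 1/ (1ℚ - q)

  [0] : [ + 0 ] ≡ 0ℚ
  [0] = solve 1 (λ d → (con 1ℚ :- con 1ℚ) :* d := con 0ℚ) refl (1/ (1ℚ - q))

  [1] : [ + 1 ] ≡ 1ℚ
  [1] = trans (cong (λ e → (1ℚ - e) * 1/ (1ℚ - q)) (ℚP.*-identityʳ q)) (ℚP.*-inverseʳ (1ℚ - q))

  [-]-shift : ∀ x a → q ^ℕ a * [ x ℤ.- + a ] ≡ [ x ] - [ + a ]
  [-]-shift x a = begin
    q ^ℕ a * [ x ℤ.- + a ]                ≡⟨ solve 2 (λ u v → v := (u :+ v) :- u) refl [ + a ] _ ⟩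
    ([ + a ] + q ^ℕ a * [ x ℤ.- + a ]) - [ + a ] ≡⟨ cong (_- [ + a ]) ([+]-+ a (x ℤ.- + a)) ⟨
    [ + a ℤ.+ (x ℤ.- + a) ] - [ + a ]     ≡⟨ cong (λ w → [ w ] - [ + a ]) a+[x-a]≡x ⟩
    [ x ] - [ + a ]                       ∎
    where
      a+[x-a]≡x : + a ℤ.+ (x ℤ.- + a) ≡ x
      a+[x-a]≡x = trans (sym (ℤP.+-assoc (+ a) x (ℤ.- + a))) (xyx⁻¹≈y (+ a) x)

  ^ℕ-sum-*-prod-[-] : ∀ x (g : ℕ → ℕ) ts →
    q ^ℕ sumℕ (map g ts) * prodℚ (map (λ t → [ x ℤ.- + g t ]) ts) ≡ prodℚ (map (λ t → [ x ] - [ + g t ]) ts)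
  ^ℕ-sum-*-prod-[-] x g [] = ℚP.*-identityˡ 1ℚ
  ^ℕ-sum-*-prod-[-] x g (t ∷ ts) = begin
    q ^ℕ (g t ℕ.+ s) * ([ x ℤ.- + g t ] * p)
      ≡⟨ cong (_* ([ x ℤ.- + g t ] * p)) (^ℕ-+ q (g t) s) ⟩
    q ^ℕ g t * q ^ℕ s * ([ x ℤ.- + g t ] * p)
      ≡⟨ solve 4 (λ a b c d → (a :* b) :* (c :* d) := (a :* c) :* (b :* d)) refl
           (q ^ℕ g t) (q ^ℕ s) [ x ℤ.- + g t ] p ⟩
    q ^ℕ g t * [ x ℤ.- + g t ] * (q ^ℕ s * p)
      ≡⟨ cong₂ _*_ ([-]-shift x (g t)) (^ℕ-sum-*-prod-[-] x g ts) ⟩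
    ([ x ] - [ + g t ]) * prodℚ (map (λ t → [ x ] - [ + g t ]) ts) ∎
    where
      s = sumℕ (map g ts)
      p = prodℚ (map (λ t → [ x ℤ.- + g t ]) ts)

module Tilings (q : ℚ) where
  tilingSum : ℕ → ℕ → ℚ
  tilingSum l m = sumℚ (map (λ T → q ^ℕ rankFrom l T) (allTilings m))

  tilingSum-bottom : ∀ l m → tilingSum l (suc (suc m))
    ≡ tilingSum (suc l) (suc m) + q ^ℕ fib (suc l) * tilingSum (suc (suc l)) m
  tilingSum-bottom l m = begin
    tilingSum l (suc (suc m))
      ≡⟨ sumℚ-map-++ w (map (one ∷_) (allTilings (suc m))) (map (two ∷_) (allTilings m)) ⟩
    sumℚ (map w (map (one ∷_) (allTilings (suc m)))) + sumℚ (map w (map (two ∷_) (allTilings m)))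
      ≡⟨ cong₂ _+_ (cong sumℚ (map-∘ (allTilings (suc m)))) (cong sumℚ (map-∘ (allTilings m))) ⟨
    tilingSum (suc l) (suc m) + sumℚ (map (λ T → q ^ℕ (fib (suc l) ℕ.+ rankFrom (suc (suc l)) T)) (allTilings m))
      ≡⟨ cong (_+_ (tilingSum (suc l) (suc m)))
           (trans (cong sumℚ (map-cong (λ T → ^ℕ-+ q (fib (suc l)) (rankFrom (suc (suc l)) T)) (allTilings m)))
                  (sumℚ-map-*ˡ (q ^ℕ fib (suc l)) (λ T → q ^ℕ rankFrom (suc (suc l)) T) (allTilings m))) ⟩
    tilingSum (suc l) (suc m) + q ^ℕ fib (suc l) * tilingSum (suc (suc l)) m ∎
    where
      w : Tiling → ℚ
      w T = q ^ℕ rankFrom l T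

  -- allTilings grows columns from the bottom, so the recurrence by the topmost tile
  -- has to be derived from the one by the bottom tile.
  tilingSum-top : ∀ m l → tilingSum l (suc (suc m))
    ≡ tilingSum l (suc m) + q ^ℕ fib (suc (m ℕ.+ l)) * tilingSum l m
  tilingSum-top zero l = tilingSum-bottom l 0
  tilingSum-top (suc zero) l = begin
    tilingSum l 3
      ≡⟨ tilingSum-bottom l 1 ⟩
    tilingSum (suc l) 2 + y * one′
      ≡⟨ cong (_+ y * one′) (tilingSum-top 0 (suc l)) ⟩
    (one′ + e * one′) + y * one′
      ≡⟨ solve 3 (λ u e y → (u :+ e :* u) :+ y :* u := (u :+ y :* u) :+ e :* u) refl one′ e y ⟩
    (one′ + y * one′) + e * one′
      ≡⟨ cong (_+ e * one′) (tilingSum-top 0 l) ⟨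
    tilingSum l 2 + e * tilingSum l 1 ∎
    where
      one′ = tilingSum l 0
      y = q ^ℕ fib (suc l)
      e = q ^ℕ fib (suc (suc l))
  tilingSum-top (suc (suc m)) l = begin
    S l (4 ℕ.+ m)
      ≡⟨ tilingSum-bottom l (suc (suc m)) ⟩
    S (suc l) (3 ℕ.+ m) + y * S (suc (suc l)) (suc (suc m))
      ≡⟨ cong₂ (λ u v → u + y * v) (tilingSum-top (suc m) (suc l)) (tilingSum-top m (suc (suc l))) ⟩
    (S (suc l) (suc (suc m)) + q ^ℕ fib (suc (suc m ℕ.+ suc l)) * S (suc l) (suc m))
      + y * (S (suc (suc l)) (suc m) + q ^ℕ fib (suc (m ℕ.+ suc (suc l))) * S (suc (suc l)) m)
      ≡⟨ cong₂ (λ i j → (S (suc l) (suc (suc m)) + q ^ℕ fib (suc (suc i)) * S (suc l) (suc m))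
                         + y * (S (suc (suc l)) (suc m) + q ^ℕ fib (suc j) * S (suc (suc l)) m))
              (ℕP.+-suc m l) (trans (ℕP.+-suc m (suc l)) (cong suc (ℕP.+-suc m l))) ⟩
    (S (suc l) (suc (suc m)) + e * S (suc l) (suc m)) + y * (S (suc (suc l)) (suc m) + e * S (suc (suc l)) m)
      ≡⟨ solve 6 (λ a b c d y e → (a :+ e :* b) :+ y :* (c :+ e :* d) := (a :+ y :* c) :+ e :* (b :+ y :* d)) refl
           (S (suc l) (suc (suc m))) (S (suc l) (suc m)) (S (suc (suc l)) (suc m)) (S (suc (suc l)) m) y e ⟩
    (S (suc l) (suc (suc m)) + y * S (suc (suc l)) (suc m)) + e * (S (suc l) (suc m) + y * S (suc (suc l)) m)
      ≡⟨ cong₂ (λ u v → u + e * v) (tilingSum-bottom l (suc m)) (tilingSum-bottom l m) ⟨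
    S l (3 ℕ.+ m) + e * S l (suc (suc m)) ∎
    where
      S = tilingSum
      y = q ^ℕ fib (suc l)
      e = q ^ℕ fib (suc (suc (suc (m ℕ.+ l))))

  tilingWeight : ℕ → ℚ
  tilingWeight m = sumℚ (map (λ T → q ^ℕ rank T) (𝓕 m))

  columnWeight : List ℕ → ℕ → ℚ
  columnWeight b d = tilingWeight (col b (suc d))

  rankSum : Placement → ℕ
  rankSum P = sumℕ (map (λ p → rank (proj₂ p)) P)

  placementSum : List ℕ → ℕ → List ℕ → ℚ
  placementSum b s is = sumℚ (map (λ P → q ^ℕ rankSum P) (tilingChoices b s is))

  placementSum-∷ : ∀ b s i is →
    placementSum b s (i ∷ is) ≡ tilingWeight (col b (suc (i ∸ s))) * placementSum b (suc s) is
  placementSum-∷ b s i is = begin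
    placementSum b s (i ∷ is)
      ≡⟨ sumℚ-concatMap w (λ T → map ((i , T) ∷_) (tilingChoices b (suc s) is)) (𝓕 e) ⟩
    sumℚ (map (λ T → sumℚ (map w (map ((i , T) ∷_) (tilingChoices b (suc s) is)))) (𝓕 e))
      ≡⟨ cong sumℚ (map-cong first-tiling (𝓕 e)) ⟩
    sumℚ (map (λ T → q ^ℕ rank T * placementSum b (suc s) is) (𝓕 e))
      ≡⟨ sumℚ-map-*ʳ (placementSum b (suc s) is) (λ T → q ^ℕ rank T) (𝓕 e) ⟩
    tilingWeight e * placementSum b (suc s) is ∎
    where
      e = col b (suc (i ∸ s))
      w : Placement → ℚ
      w P = q ^ℕ rankSum P
      first-tiling : ∀ T → sumℚ (map w (map ((i , T) ∷_) (tilingChoices b (suc s) is)))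
                           ≡ q ^ℕ rank T * placementSum b (suc s) is
      first-tiling T = begin
        sumℚ (map w (map ((i , T) ∷_) (tilingChoices b (suc s) is)))
          ≡⟨ cong sumℚ (map-∘ (tilingChoices b (suc s) is)) ⟨
        sumℚ (map (λ P → q ^ℕ (rank T ℕ.+ rankSum P)) (tilingChoices b (suc s) is))
          ≡⟨ cong sumℚ (map-cong (λ P → ^ℕ-+ q (rank T) (rankSum P)) (tilingChoices b (suc s) is)) ⟩
        sumℚ (map (λ P → q ^ℕ rank T * w P) (tilingChoices b (suc s) is))
          ≡⟨ sumℚ-map-*ˡ (q ^ℕ rank T) w (tilingChoices b (suc s) is) ⟩
        q ^ℕ rank T * placementSum b (suc s) is ∎

  -- f lists consecutive columns; a d is the weight of column f d after the s rooks to its left.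
  sumℚ-placementSum-choose : ∀ b (a : ℕ → ℚ) (f : ℕ → ℕ) s m j →
    (∀ d → f (suc d) ≡ suc (f d)) → (∀ d → a d ≡ tilingWeight (col b (suc (f d ∸ s)))) →
    sumℚ (map (placementSum b s) (choose (applyUpTo f m) j)) ≡ rook a m j
  sumℚ-placementSum-choose b a f s m zero f-suc a≡ = trans (ℚP.+-identityʳ _) (ℚP.+-identityʳ 1ℚ)
  sumℚ-placementSum-choose b a f s zero (suc j) f-suc a≡ = refl
  sumℚ-placementSum-choose b a f s (suc m) (suc j) f-suc a≡ = begin
    sumℚ (map (placementSum b s) (map (f 0 ∷_) (choose cols j) ++ choose cols (suc j)))
      ≡⟨ sumℚ-map-++ (placementSum b s) (map (f 0 ∷_) (choose cols j)) (choose cols (suc j)) ⟩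
    sumℚ (map (placementSum b s) (map (f 0 ∷_) (choose cols j))) + sumℚ (map (placementSum b s) (choose cols (suc j)))
      ≡⟨ cong (_+ sumℚ (map (placementSum b s) (choose cols (suc j)))) rook-in-first-column ⟩
    a 0 * rook a m j + sumℚ (map (placementSum b s) (choose cols (suc j)))
      ≡⟨ cong (_+_ (a 0 * rook a m j))
           (sumℚ-placementSum-choose b (a ∘ suc) (f ∘ suc) s m (suc j) (f-suc ∘ suc) (a≡ ∘ suc)) ⟩
    a 0 * rook a m j + rook (a ∘ suc) m (suc j) ∎
    where
      cols = applyUpTo (f ∘ suc) m
      a≡′ : ∀ d → a d ≡ tilingWeight (col b (suc (f (suc d) ∸ suc s)))
      a≡′ d = trans (a≡ d) (cong (λ i → tilingWeight (col b (suc (i ∸ suc s)))) (sym (f-suc d)))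
      rook-in-first-column : sumℚ (map (placementSum b s) (map (f 0 ∷_) (choose cols j))) ≡ a 0 * rook a m j
      rook-in-first-column = begin
        sumℚ (map (placementSum b s) (map (f 0 ∷_) (choose cols j)))
          ≡⟨ cong sumℚ (map-∘ (choose cols j)) ⟨
        sumℚ (map (λ is → placementSum b s (f 0 ∷ is)) (choose cols j))
          ≡⟨ cong sumℚ (map-cong (λ is → trans (placementSum-∷ b s (f 0) is)
                                        (cong (_* placementSum b (suc s) is) (sym (a≡ 0)))) (choose cols j)) ⟩
        sumℚ (map (λ is → a 0 * placementSum b (suc s) is) (choose cols j))
          ≡⟨ sumℚ-map-*ˡ (a 0) (placementSum b (suc s)) (choose cols j) ⟩
        a 0 * sumℚ (map (placementSum b (suc s)) (choose cols j))
          ≡⟨ cong (a 0 *_) (sumℚ-placementSum-choose b a (f ∘ suc) (suc s) m j (f-suc ∘ suc) a≡′) ⟩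
        a 0 * rook a m j ∎

  RT≡rook : ∀ b j → RT j b q ≡ q ^ℕ sumℕ (map fib (take (length b ∸ j) b)) * rook (columnWeight b) (length b) j
  RT≡rook b j = begin
    sumℚ (map (W b j q) (NT j b))
      ≡⟨ cong sumℚ (map-cong (λ P → trans (^ℕ-+ q (rankSum P) c) (ℚP.*-comm _ (q ^ℕ c))) (NT j b)) ⟩
    sumℚ (map (λ P → q ^ℕ c * q ^ℕ rankSum P) (NT j b))
      ≡⟨ sumℚ-map-*ˡ (q ^ℕ c) (λ P → q ^ℕ rankSum P) (NT j b) ⟩
    q ^ℕ c * sumℚ (map (λ P → q ^ℕ rankSum P) (NT j b))
      ≡⟨ cong (q ^ℕ c *_) (sumℚ-concatMap (λ P → q ^ℕ rankSum P) (tilingChoices b 1) (choose (columns n) j)) ⟩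
    q ^ℕ c * sumℚ (map (placementSum b 1) (choose (columns n) j))
      ≡⟨ cong (λ cs → q ^ℕ c * sumℚ (map (placementSum b 1) (choose cs j))) (map-applyUpTo id suc n) ⟩
    q ^ℕ c * sumℚ (map (placementSum b 1) (choose (applyUpTo suc n) j))
      ≡⟨ cong (q ^ℕ c *_) (sumℚ-placementSum-choose b (columnWeight b) suc 1 n j (λ _ → refl) (λ _ → refl)) ⟩
    q ^ℕ c * rook (columnWeight b) n j ∎
    where
      n = length b
      c = sumℕ (map fib (take (n ∸ j) b))

module ColumnWeights (q : ℚ) (q≢0 : q ≢ 0ℚ) (q≢1 : q ≢ 1ℚ) where
  open QIntegers q q≢0 q≢1
  open Tilings q

  tilingSum-one≡[fib] : ∀ m → tilingSum 1 m ≡ [ + fib (suc m) ]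
  tilingSum-one≡[fib] zero = trans (ℚP.+-identityʳ 1ℚ) (sym [1])
  tilingSum-one≡[fib] (suc zero) = trans (ℚP.+-identityʳ 1ℚ) (sym [1])
  tilingSum-one≡[fib] (suc (suc m)) = begin
    tilingSum 1 (suc (suc m))
      ≡⟨ tilingSum-top m 1 ⟩
    tilingSum 1 (suc m) + q ^ℕ fib (suc (m ℕ.+ 1)) * tilingSum 1 m
      ≡⟨ cong (λ i → tilingSum 1 (suc m) + q ^ℕ fib (suc i) * tilingSum 1 m) (ℕP.+-comm m 1) ⟩
    tilingSum 1 (suc m) + q ^ℕ fib (suc (suc m)) * tilingSum 1 m
      ≡⟨ cong₂ (λ u v → u + q ^ℕ fib (suc (suc m)) * v) (tilingSum-one≡[fib] (suc m)) (tilingSum-one≡[fib] m) ⟩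
    [ + fib (suc (suc m)) ] + q ^ℕ fib (suc (suc m)) * [ + fib (suc m) ]
      ≡⟨ [+]-+ (fib (suc (suc m))) (+ fib (suc m)) ⟨
    [ + fib (suc (suc (suc m))) ] ∎

  tilingWeight≡[fib] : ∀ m → tilingWeight m ≡ [ + fib m ]
  tilingWeight≡[fib] zero = sym [0]
  tilingWeight≡[fib] (suc m) = trans (cong sumℚ (sym (map-∘ (allTilings m)))) (tilingSum-one≡[fib] m)

  falling-columnWeight : ∀ X b k → k ≤ length b →
    falling X (columnWeight b) k ≡ prodℚ (map (λ t → X - [ + fib t ]) (take k b))
  falling-columnWeight X b zero _ = refl
  falling-columnWeight X (t ∷ b) (suc k) (s≤s k≤n) =
    cong₂ _*_ (cong (X -_) (tilingWeight≡[fib] t)) (falling-columnWeight X b k k≤n)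

  RT-*-prod≡rook-*-falling : ∀ b x k → k ≤ length b →
    let n = length b in
    RT (n ∸ k) b q * prodℚ (map (λ t → [ x ℤ.- + fib t ]) (take k b))
      ≡ rook (columnWeight b) n (n ∸ k) * falling [ x ] (columnWeight b) k
  RT-*-prod≡rook-*-falling b x k k≤n = begin
    RT (n ∸ k) b q * p
      ≡⟨ cong (_* p) (RT≡rook b (n ∸ k)) ⟩
    q ^ℕ c (n ∸ (n ∸ k)) * r * p
      ≡⟨ cong (λ i → q ^ℕ c i * r * p) (ℕP.m∸[m∸n]≡n k≤n) ⟩
    q ^ℕ c k * r * p
      ≡⟨ solve 3 (λ e r p → (e :* r) :* p := r :* (e :* p)) refl (q ^ℕ c k) r p ⟩
    r * (q ^ℕ c k * p)
      ≡⟨ cong (r *_) (^ℕ-sum-*-prod-[-] x fib (take k b)) ⟩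
    r * prodℚ (map (λ t → [ x ] - [ + fib t ]) (take k b))
      ≡⟨ cong (r *_) (falling-columnWeight [ x ] b k k≤n) ⟨
    r * falling [ x ] (columnWeight b) k ∎
    where
      n = length b
      r = rook (columnWeight b) n (n ∸ k)
      c = λ i → sumℕ (map fib (take i b))
      p = prodℚ (map (λ t → [ x ℤ.- + fib t ]) (take k b))

theorem9 : (b : List ℕ) → Linked _≤_ b → 0 < lastOr0 b →
    (x : ℤ) → + lastOr0 b ℤ.≤ x →
    (q : ℚ) (q≢0 : q ≢ 0ℚ) (q≢1 : q ≢ 1ℚ) →
    let n = length b in
    qint x q q≢0 q≢1 ^ℕ n
      ≡ sumℚ (map (λ k → RT (n ∸ k) b q
                   * prodℚ (map (λ t → qint (x ℤ.- + fib t) q q≢0 q≢1) (take k b)))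
                  (upTo (suc n)))
theorem9 b _ _ x _ q q≢0 q≢1 = begin
  [ x ] ^ℕ n                             ≡⟨ rookExpansion≡^ [ x ] (columnWeight b) n ⟨
  rookExpansion [ x ] (columnWeight b) n ≡⟨ sumBelow-cong (suc n) (λ k k<1+n → sym
                                              (RT-*-prod≡rook-*-falling b x k (ℕP.≤-pred k<1+n))) ⟩
  sumBelow (suc n) summand               ≡⟨ sumℚ-map-applyUpTo summand id (suc n) ⟨
  sumℚ (map summand (upTo (suc n)))      ∎
  where
    open QIntegers q q≢0 q≢1
    open Tilings q
    open ColumnWeights q q≢0 q≢1
    n = length b
    summand : ℕ → ℚ
    summand k = RT (n ∸ k) b q * prodℚ (map (λ t → [ x ℤ.- + fib t ]) (take k b))
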